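{- Let $(\mathcal{O},g,f)$ be an oriented matroid program of rank $r\ge3$ and let $C,X,Y$ be pairwise comodular cocircuits such that $z(C\circ X\circ Y)$ is a flat of rank $r-3$. Let $X_g=Y_g=+$ and $C_g=C_f=0$. Let $X^1,Y^1$ be distinct cocircuits with $X^1_g=Y^1_g=+$, with $z(X^1)\supseteq z(X\circ C)$ and $z(Y^1)\supseteq z(Y\circ C)$, $X\ne X^1\ne C$, $Y\ne Y^1\ne C$, and such that $X^1\circ Y^1$ is an edge (i.e. $z(X^1\circ Y^1)$ is a flat of rank $r-2$). Then $X^1\leftrightarrow X$ and $Y^1\leftrightarrow Y$, and moreover $X^1\to Y^1$ if and only if $X\to Y$ (all directions taken in $(\mathcal{O},g,f)$).
   Context: $\mathcal{O}$ is an oriented matroid on $E$ of rank $r$ given by covectors in $\{+,-,0\}^E$; cocircuits are minimal nonzero covectors; $z(X)=\{e:X_e=0\}$, $\mathrm{sep}(X,Y)=\{e:X_e=-Y_e\ne0\}$. Cocircuits $X\ne\pm Y$ are comodular if $z(X\circ Y)$ is a flat of rank $r-2$; then for $e\in\mathrm{sep}(X,Y)$, cocircuit elimination of $e$ yields the unique cocircuit $Z$ with $Z_e=0$, $\mathrm{supp}(Z)\subseteq\mathrm{supp}(X\circ Y)\setminus\{e\}$. An oriented matroid program $(\mathcal{O},g,f)$: distinct $g,f$, $g$ not a loop, $f$ not a coloop. For comodular $X,Y$ with $X_g=Y_g\ne0$ and $Z$ the elimination of $g$ between $-X$ and $Y$: $X\to Y$ if $Z_f=+$, $X\leftarrow Y$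 if $Z_f=-$, $X\leftrightarrow Y$ if $Z_f=0$. -}

module Defs where

open import Data.Nat using (ℕ; zero; suc; _∸_)
open import Data.Fin using (Fin)
open import Data.Product using (Σ; _×_; _,_)
open import Data.Sum using (_⊎_)
open import Data.Unit using (⊤)
open import Data.Empty using (⊥)
open import Relation.Nullary using (¬_)
open import Relation.Binary.PropositionalEquality using (_≡_; _≢_)

data Sign : Set where
  plus minus zer : Sign

negS : Sign → Sign
negS plus = minus
negS minus = plus
negS zer = zer

SVec : ℕ → Set
SVec n = Fin n → Sign

module _ {n : ℕ} where

  zeroV : SVec n
  zeroV _ = zer

  -_ : SVec n → SVec n
  (- X) e = negS (X e)

  _∘_ : SVec n → SVec n → SVec n
  (X ∘ Y) e with X e
  ... | zer = Y e
  ... | s = s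

  _≈_ : SVec n → SVec n → Set
  X ≈ Y = ∀ e → X e ≡ Y e

  InSep : SVec n → SVec n → Fin n → Set
  InSep X Y e = (X e ≡ negS (Y e)) × (X e ≢ zer)

  -- zero sets z(X) as predicates; inclusions between them
  _⊆z_ : SVec n → SVec n → Set
  X ⊆z Y = ∀ e → X e ≡ zer → Y e ≡ zer

  _⊂z_ : SVec n → SVec n → Set
  X ⊂z Y = X ⊆z Y × Σ (Fin n) (λ e → (Y e ≡ zer) × (X e ≢ zer))

  _≤c_ : SVec n → SVec n → Set
  X ≤c Y = ∀ e → (X e ≡ zer) ⊎ (X e ≡ Y e)

-- Oriented matroid on Fin n given by its set of covectors (axioms L0–L3)
record OM (n : ℕ) : Set₁ where
  field
    L : SVec n → Set
    L0 : L zeroV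
    L1 : ∀ X → L X → L (- X)
    L2 : ∀ X Y → L X → L Y → L (X ∘ Y)
    L3 : ∀ X Y → L X → L Y → ∀ e → InSep X Y e →
         Σ (SVec n) λ Z → L Z × (Z e ≡ zer) ×
           (∀ h → ¬ InSep X Y h → Z h ≡ (X ∘ Y) h)

module _ {n : ℕ} (O : OM n) where
  open OM O

  Cocircuit : SVec n → Set
  Cocircuit X = L X × ¬ (X ≈ zeroV) ×
    (∀ Y → L Y → ¬ (Y ≈ zeroV) → Y ≤c X → Y ≈ X)

  -- chains of flats (flats = zero sets of covectors) of length k ending at z(W)
  HasChain : ℕ → SVec n → Set
  HasChain zero W = ⊤
  HasChain (suc k) W = Σ (SVec n) λ V → L V × (V ⊂z W) × HasChain k V

  -- z(W) has rank k in the lattice of flats (height of z(W))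
  FlatRank : SVec n → ℕ → Set
  FlatRank W k = HasChain k W × ¬ HasChain (suc k) W

  -- rank of the oriented matroid = rank of E = z(0)
  Rank : ℕ → Set
  Rank r = FlatRank zeroV r

  Loop : Fin n → Set
  Loop e = ∀ X → L X → X e ≡ zer

  Coloop : Fin n → Set
  Coloop e = Σ (SVec n) λ X → Cocircuit X × (X e ≢ zer) × (∀ h → h ≢ e → X h ≡ zer)

  IsProgram : Fin n → Fin n → Set
  IsProgram g f = (g ≢ f) × ¬ Loop g × ¬ Coloop f

  Comodular : ℕ → SVec n → SVec n → Set
  Comodular r X Y = Cocircuit X × Cocircuit Y × ¬ (X ≈ Y) × ¬ (X ≈ (- Y)) ×
                    FlatRank (X ∘ Y) (r ∸ 2)

  Elim : Fin n → SVec n → SVec n → SVec n → Set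
  Elim e X Y Z = Cocircuit Z × (Z e ≡ zer) ×
    (∀ h → (Z h ≡ zer) ⊎ ((Z h ≡ X h) × (X h ≢ zer)) ⊎ ((Z h ≡ Y h) × (Y h ≢ zer)))
    × (∀ h → X h ≡ zer → Y h ≡ zer → Z h ≡ zer)

  Dir : ℕ → Fin n → Fin n → Sign → SVec n → SVec n → Set
  Dir r g f s X Y = Comodular r X Y × (X g ≡ Y g) × (X g ≢ zer) ×
    Σ (SVec n) λ Z → Elim g (- X) Y Z × (Z f ≡ s)

  Arr : ℕ → Fin n → Fin n → SVec n → SVec n → Set
  Arr r g f X Y = Dir r g f plus X Y

  Bi : ℕ → Fin n → Fin n → SVec n → SVec n → Set
  Bi r g f X Y = Dir r g f zer X Y

{-# OPTIONS --safe #-}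
module Submission where

-- Everything is a count of ranks in the lattice of flats: between a coline z(K) (rank r − 2) and a
-- hyperplane containing it there is no room for a further flat. Hence covectors vanishing on a coline
-- z(K) ⊆ z(C) coincide on z(C) up to a global sign, and two distinct cocircuits through z(X ∘ C) that are
-- positive at g meet exactly in z(X ∘ C). So z(X1 ∘ X) = z(X ∘ C) and, as C_f = 0, the elimination of g
-- between −X1 and X vanishes at f: X1 ↔ X, and likewise Y1 ↔ Y. For the equivalence, the eliminations
-- Z (of −X, Y) and Z' (of −X1, Y1) vanish on the coline z(Z ∘ C ∘ Z') ⊋ z(C ∘ X ∘ Y) and agree at a point
-- of z(X) ∩ z(C) outside z(Y), where Z = Y = Y1 = Z'; hence they agree at f ∈ z(C).

open import Defs
open import Data.Nat using (ℕ; zero; suc; _+_; _≤_; _∸_; s≤s; z≤n)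
open import Data.Fin using (Fin)
open import Data.Fin.Properties using (all?; ¬∀⟶∃¬)
open import Data.Product using (_×_; Σ; _,_; proj₁; proj₂)
open import Data.Sum using (_⊎_; inj₁; inj₂)
open import Data.Empty using (⊥-elim)
open import Data.Unit using (tt)
open import Relation.Nullary using (¬_; Dec; yes; no)
open import Relation.Nullary.Decidable using (_×-dec_; _→-dec_; ¬?)
open import Relation.Binary.Definitions using (DecidableEquality)
open import Relation.Binary.PropositionalEquality using (_≡_; _≢_; refl; sym; trans; cong)
open import Function.Bundles using (_⇔_; mk⇔)

_≟ˢ_ : DecidableEquality Sign
plus  ≟ˢ plus  = yes refl
minus ≟ˢ minus = yes refl
zer   ≟ˢ zer   = yes refl
plus  ≟ˢ minus = no λ ()
plus  ≟ˢ zer   = no λ ()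
minus ≟ˢ plus  = no λ ()
minus ≟ˢ zer   = no λ ()
zer   ≟ˢ plus  = no λ ()
zer   ≟ˢ minus = no λ ()

plus≢zer : plus ≢ zer
plus≢zer ()

negS-involutive : ∀ s → negS (negS s) ≡ s
negS-involutive plus  = refl
negS-involutive minus = refl
negS-involutive zer   = refl

negS-zero⁻¹ : ∀ {s} → negS s ≡ zer → s ≡ zer
negS-zero⁻¹ {zer} _ = refl

≡negS⇒zero : ∀ {s} → s ≡ negS s → s ≡ zer
≡negS⇒zero {zer} _ = refl

negS-injective : ∀ {s t} → negS s ≡ negS t → s ≡ t
negS-injective {s} {t} p = trans (sym (negS-involutive s)) (trans (cong negS p) (negS-involutive t))

≢⇒≡negS : ∀ {a b} → a ≢ zer → b ≢ zer → a ≢ b → a ≡ negS b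
≢⇒≡negS {plus}  {minus} _ _ _ = refl
≢⇒≡negS {minus} {plus}  _ _ _ = refl
≢⇒≡negS {plus}  {plus}  _ _ a≢b = ⊥-elim (a≢b refl)
≢⇒≡negS {minus} {minus} _ _ a≢b = ⊥-elim (a≢b refl)
≢⇒≡negS {zer}   a≢0 _ _ = ⊥-elim (a≢0 refl)
≢⇒≡negS {_}     {zer} _ b≢0 _ = ⊥-elim (b≢0 refl)

module _ {n : ℕ} where

  ∘-nonzero : ∀ (A B : SVec n) {e} → A e ≢ zer → (A ∘ B) e ≡ A e
  ∘-nonzero A B {e} A≢0 with A e
  ... | plus  = refl
  ... | minus = refl
  ... | zer   = ⊥-elim (A≢0 refl)

  ∘-zero : ∀ (A B : SVec n) {e} → A e ≡ zer → (A ∘ B) e ≡ B e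
  ∘-zero A B A0 rewrite A0 = refl

  ∘-cases : ∀ (A B : SVec n) e → (A ∘ B) e ≡ A e ⊎ (A ∘ B) e ≡ B e
  ∘-cases A B e with A e ≟ˢ zer
  ... | yes A0  = inj₂ (∘-zero A B A0)
  ... | no  A≢0 = inj₁ (∘-nonzero A B A≢0)

  ∘-idem-at : ∀ (A B : SVec n) {e} → A e ≡ B e → (A ∘ B) e ≡ A e
  ∘-idem-at A B {e} A≡B with A e ≟ˢ zer
  ... | yes A0  = trans (∘-zero A B A0) (sym A≡B)
  ... | no  A≢0 = ∘-nonzero A B A≢0

  ∘-vanishes : ∀ (A B : SVec n) {e} → A e ≡ zer → B e ≡ zer → (A ∘ B) e ≡ zer
  ∘-vanishes A B A0 B0 = trans (∘-zero A B A0) B0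

  ∘-⊆zˡ : ∀ (A B : SVec n) → (A ∘ B) ⊆z A
  ∘-⊆zˡ A B e p with A e
  ... | zer = refl

  ∘-⊆zʳ : ∀ (A B : SVec n) → (A ∘ B) ⊆z B
  ∘-⊆zʳ A B e p = trans (sym (∘-zero A B (∘-⊆zˡ A B e p))) p

  ⊆z-∘ : ∀ {K : SVec n} A B → K ⊆z A → K ⊆z B → K ⊆z (A ∘ B)
  ⊆z-∘ A B K⊆A K⊆B e p = ∘-vanishes A B (K⊆A e p) (K⊆B e p)

  ⊆z-trans : ∀ {A B D : SVec n} → A ⊆z B → B ⊆z D → A ⊆z D
  ⊆z-trans A⊆B B⊆D e p = B⊆D e (A⊆B e p)

  ∘-comm-⊆z : ∀ (A B : SVec n) → (A ∘ B) ⊆z (B ∘ A)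
  ∘-comm-⊆z A B = ⊆z-∘ B A (∘-⊆zʳ A B) (∘-⊆zˡ A B)

  ∘-nonzeroˡ : ∀ (A B : SVec n) {e} → A e ≢ zer → (A ∘ B) e ≢ zer
  ∘-nonzeroˡ A B A≢0 p = A≢0 (∘-⊆zˡ A B _ p)

  ∘-nonzeroʳ : ∀ (A B : SVec n) {e} → B e ≢ zer → (A ∘ B) e ≢ zer
  ∘-nonzeroʳ A B B≢0 p = B≢0 (∘-⊆zʳ A B _ p)

  all⊎∃¬ : (P : Fin n → Set) → (∀ i → Dec (P i)) → (∀ i → P i) ⊎ Σ (Fin n) (λ i → ¬ P i)
  all⊎∃¬ P P? with all? P?
  ... | yes ∀P = inj₁ ∀P
  ... | no ¬∀P = inj₂ (¬∀⟶∃¬ n P P? ¬∀P)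

  ≈⊎∃≢ : (A B : SVec n) → A ≈ B ⊎ Σ (Fin n) (λ e → A e ≢ B e)
  ≈⊎∃≢ A B = all⊎∃¬ (λ e → A e ≡ B e) (λ e → A e ≟ˢ B e)

  ⊆z⊎∃ : (A B : SVec n) → A ⊆z B ⊎ Σ (Fin n) (λ e → A e ≡ zer × B e ≢ zer)
  ⊆z⊎∃ A B with all⊎∃¬ (λ e → A e ≡ zer → B e ≡ zer) (λ e → A e ≟ˢ zer →-dec B e ≟ˢ zer)
  ... | inj₁ A⊆B = inj₁ A⊆B
  ... | inj₂ (e , ¬A⇒B) with A e ≟ˢ zer
  ...   | yes A0  = inj₂ (e , A0 , λ B0 → ¬A⇒B (λ _ → B0))
  ...   | no  A≢0 = ⊥-elim (¬A⇒B (λ A0 → ⊥-elim (A≢0 A0)))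

  InSep? : (A B : SVec n) → ∀ e → Dec (InSep A B e)
  InSep? A B e = (A e ≟ˢ negS (B e)) ×-dec ¬? (A e ≟ˢ zer)

  eliminant-agrees : ∀ {A B V : SVec n} → (∀ x → ¬ InSep A B x → V x ≡ (A ∘ B) x) →
                     ∀ {h} → A h ≡ B h → V h ≡ A h
  eliminant-agrees {A} {B} out {h} A≡B = trans (out h not-sep) (∘-idem-at A B A≡B)
    where
    not-sep : ¬ InSep A B h
    not-sep (A≡-B , A≢0) = A≢0 (≡negS⇒zero (trans A≡-B (cong negS (sym A≡B))))

module Covectors {n : ℕ} (O : OM n) where
  open OM O

  Elim-intro : ∀ {e P Q W} → Cocircuit O W → W e ≡ zer →
               (∀ h → ¬ InSep P Q h → W h ≡ (P ∘ Q) h) → Elim O e P Q W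
  Elim-intro {P = P} {Q} {W} cW We out = cW , We , signs , vanishes
    where
    signs : ∀ h → (W h ≡ zer) ⊎ ((W h ≡ P h) × (P h ≢ zer)) ⊎ ((W h ≡ Q h) × (Q h ≢ zer))
    signs h with W h ≟ˢ zer | W h ≟ˢ P h | W h ≟ˢ Q h
    ... | yes W0  | _       | _       = inj₁ W0
    ... | no  W≢0 | yes W≡P | _       = inj₂ (inj₁ (W≡P , λ P0 → W≢0 (trans W≡P P0)))
    ... | no  W≢0 | no  _   | yes W≡Q = inj₂ (inj₂ (W≡Q , λ Q0 → W≢0 (trans W≡Q Q0)))
    ... | no  W≢0 | no  W≢P | no  W≢Q with InSep? P Q h
    ...   | yes (P≡-Q , P≢0) =
            ⊥-elim (W≢Q (trans (≢⇒≡negS W≢0 P≢0 W≢P) (trans (cong negS P≡-Q) (negS-involutive (Q h)))))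
    ...   | no  ¬sep with ∘-cases P Q h
    ...     | inj₁ P∘Q≡P = ⊥-elim (W≢P (trans (out h ¬sep) P∘Q≡P))
    ...     | inj₂ P∘Q≡Q = ⊥-elim (W≢Q (trans (out h ¬sep) P∘Q≡Q))
    vanishes : ∀ h → P h ≡ zer → Q h ≡ zer → W h ≡ zer
    vanishes h P0 Q0 = trans (eliminant-agrees out (trans P0 (sym Q0))) P0

  Elim-⊆z : ∀ {e A B Z} → Elim O e (- A) B Z → (A ∘ B) ⊆z Z
  Elim-⊆z {A = A} {B} (_ , _ , _ , vanishes) x p =
    vanishes x (cong negS (∘-⊆zˡ A B x p)) (∘-⊆zʳ A B x p)

  Elim-at : ∀ {e A B Z h} → Elim O e (- A) B Z → A h ≡ zer → Z h ≢ zer → Z h ≡ B h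
  Elim-at {h = h} (_ , _ , signs , _) A0 Z≢0 with signs h
  ... | inj₁ Z0                = ⊥-elim (Z≢0 Z0)
  ... | inj₂ (inj₁ (_ , -A≢0)) = ⊥-elim (-A≢0 (cong negS A0))
  ... | inj₂ (inj₂ (Z≡B , _))  = Z≡B

  comodular-of-signs : ∀ r {g A B} → Cocircuit O A → Cocircuit O B → ¬ A ≈ B →
                       A g ≡ plus → B g ≡ plus → FlatRank O (A ∘ B) (r ∸ 2) → Comodular O r A B
  comodular-of-signs r {g} {A} {B} cA cB A≉B Ag Bg fr = cA , cB , A≉B , A≉-B , fr
    where
    A≉-B : ¬ A ≈ (- B)
    A≉-B A≈-B with trans (sym Ag) (trans (A≈-B g) (cong negS Bg))
    ... | ()

  covector-⊃z : ∀ {g P P1} → L P → L P1 → P g ≡ plus → P1 g ≡ plus → P ⊆z P1 → ¬ P ≈ P1 →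
                Σ (SVec n) λ W → L W × ¬ W ≈ zeroV × P ⊂z W
  covector-⊃z {g} {P} {P1} LP LP1 Pg P1g P⊆P1 P≉P1 with ≈⊎∃≢ P P1
  ... | inj₁ P≈P1 = ⊥-elim (P≉P1 P≈P1)
  ... | inj₂ (d , Pd≢P1d) with P d ≟ˢ zer | P1 d ≟ˢ zer
  ...   | yes P0  | _        = ⊥-elim (Pd≢P1d (trans P0 (sym (P⊆P1 d P0))))
  ...   | no  P≢0 | yes P1d0 = P1 , LP1 , (λ q → plus≢zer (trans (sym P1g) (q g))) , P⊆P1 , d , P1d0 , P≢0
  ...   | no  P≢0 | no  P1≢0 with L3 P P1 LP LP1 d (≢⇒≡negS P≢0 P1≢0 Pd≢P1d , P≢0)
  ...     | W , LW , Wd , out = W , LW , W≉0 , P⊆W , d , Wd , P≢0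
    where
    W≉0 : ¬ W ≈ zeroV
    W≉0 W≈0 = plus≢zer (trans (sym Pg) (trans (sym (eliminant-agrees out (trans Pg (sym P1g)))) (W≈0 g)))
    P⊆W : P ⊆z W
    P⊆W x Px = trans (eliminant-agrees out (trans Px (sym (P⊆P1 x Px)))) Px

-- The oriented matroid has rank 3 + R.
module Chains {n : ℕ} (O : OM n) (R : ℕ) (rank : ¬ HasChain O (4 + R) zeroV) where
  open OM O
  open Covectors O public

  chain-step : ∀ {k V W} → L V → V ⊆z W → ∀ {e} → W e ≡ zer → V e ≢ zer →
               HasChain O k V → HasChain O (suc k) W
  chain-step {V = V} LV V⊆W We V≢0 ch = V , LV , (V⊆W , _ , We , V≢0) , ch

  HasChain-mono : ∀ {k U U'} → U ⊆z U' → HasChain O k U → HasChain O k U'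
  HasChain-mono {zero}  _    _ = tt
  HasChain-mono {suc k} U⊆U' (V , LV , (V⊆U , e , Ue , V≢0) , ch) =
    chain-step LV (⊆z-trans V⊆U U⊆U') (U⊆U' e Ue) V≢0 ch

  long-chain⇒zero : ∀ {W} → L W → HasChain O (3 + R) W → W ≈ zeroV
  long-chain⇒zero {W} LW ch e with W e ≟ˢ zer
  ... | yes W0  = W0
  ... | no  W≢0 = ⊥-elim (rank (chain-step LW (λ _ _ → refl) refl W≢0 ch))

  -- Otherwise z(K) ⊊ z(V ∘ W) ⊊ z(W) extends a chain of length r − 2 to one of length r below W ≠ 0.
  nonzero-off-coline : ∀ {K V W} → L K → L V → L W → ¬ W ≈ zeroV → HasChain O (suc R) K →
                       K ⊆z V → K ⊆z W → ∀ {a b} → W a ≡ zer → V a ≢ zer →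
                       W b ≡ zer → K b ≢ zer → V b ≢ zer
  nonzero-off-coline {V = V} {W} LK LV LW W≉0 chK K⊆V K⊆W Wa Va Wb Kb Vb =
    W≉0 (long-chain⇒zero LW
      (chain-step (L2 V W LV LW) (∘-⊆zʳ V W) Wa (∘-nonzeroˡ V W Va)
        (chain-step LK (⊆z-∘ V W K⊆V K⊆W) (∘-vanishes V W Vb Wb) Kb chK)))

  long-chain⇒cocircuit : ∀ {W} → L W → ¬ W ≈ zeroV → HasChain O (2 + R) W → Cocircuit O W
  long-chain⇒cocircuit {W} LW W≉0 ch = LW , W≉0 , minimal
    where
    minimal : ∀ Y → L Y → ¬ Y ≈ zeroV → Y ≤c W → Y ≈ W
    minimal Y LY Y≉0 Y≤W e with Y≤W e | W e ≟ˢ zer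
    ... | inj₂ Y≡W | _       = Y≡W
    ... | inj₁ Y0  | yes W0  = trans Y0 (sym W0)
    ... | inj₁ Y0  | no  W≢0 = ⊥-elim (Y≉0 (long-chain⇒zero LY (chain-step LW W⊆Y Y0 W≢0 ch)))
      where
      W⊆Y : W ⊆z Y
      W⊆Y x W0 with Y≤W x
      ... | inj₁ Y0   = Y0
      ... | inj₂ Y≡W = trans Y≡W W0

  elimination-exists : ∀ {g A B} → Comodular O (3 + R) A B → A g ≡ plus → B g ≡ plus →
                       Σ (SVec n) (Elim O g (- A) B)
  elimination-exists {g} {A} {B} ((LA , _) , (LB , _) , A≉B , _ , chAB , _) Ag Bg
    with L3 (- A) B (L1 A LA) LB g
            (cong negS (trans Ag (sym Bg)) , λ p → plus≢zer (trans (sym Ag) (negS-zero⁻¹ p)))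
  ... | W , LW , Wg , out = W , Elim-intro (long-chain⇒cocircuit LW W≉0 chW) Wg out
    where
    A∘B⊆W : (A ∘ B) ⊆z W
    A∘B⊆W x p = trans (eliminant-agrees out (trans -A0 (sym (∘-⊆zʳ A B x p)))) -A0
      where -A0 = cong negS (∘-⊆zˡ A B x p)
    chW : HasChain O (2 + R) W
    chW = chain-step (L2 A B LA LB) A∘B⊆W Wg (∘-nonzeroˡ A B (λ p → plus≢zer (trans (sym Ag) p))) chAB
    W≉0 : ¬ W ≈ zeroV
    W≉0 W≈0 with ≈⊎∃≢ A B
    ... | inj₁ A≈B = A≉B A≈B
    ... | inj₂ (d , A≢B) =
          A≢B (trans (negS-zero⁻¹ (∘-⊆zˡ (- A) B d -A∘B0)) (sym (∘-⊆zʳ (- A) B d -A∘B0)))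
      where
      -A∘B0 : ((- A) ∘ B) d ≡ zer
      -A∘B0 = trans (sym (out d λ (-A≡-B , _) → A≢B (negS-injective -A≡-B))) (W≈0 d)

  elimination-at : ∀ {g A B Z h} → Comodular O (3 + R) A B → A g ≡ plus → Elim O g (- A) B Z →
                   A h ≡ zer → B h ≢ zer → Z h ≡ B h
  elimination-at {A = A} {B} ((LA , _) , (LB , _) , _ , _ , chAB , _) Ag
                 el@((LZ , Z≉0 , _) , Zg , _) A0 B≢0 =
    Elim-at el A0 λ Z0 →
      nonzero-off-coline (L2 A B LA LB) LA LZ Z≉0 chAB (∘-⊆zˡ A B) (Elim-⊆z el)
                         Zg (λ p → plus≢zer (trans (sym Ag) p)) Z0 (∘-nonzeroʳ A B B≢0) A0

  -- In the contraction to the coline z(K) the hyperplane z(C) is a single point, so covectors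
  -- vanishing on z(K) coincide on z(C) up to a global sign.
  agreement-spreads : ∀ {K Z Z' C} → L K → L Z → L Z' → L C → ¬ C ≈ zeroV → HasChain O (suc R) K →
                      K ⊆z Z → K ⊆z Z' → K ⊆z C → ∀ {a} → C a ≡ zer → Z a ≡ Z' a → Z a ≢ zer →
                      ∀ {b} → C b ≡ zer → Z b ≡ Z' b
  agreement-spreads {K} {Z} {Z'} LK LZ LZ' LC C≉0 chK K⊆Z K⊆Z' K⊆C Ca Za≡Z'a Za≢0 {b} Cb
    with K b ≟ˢ zer | Z b ≟ˢ zer | Z' b ≟ˢ zer
  ... | yes K0 | _      | _       = trans (K⊆Z b K0) (sym (K⊆Z' b K0))
  ... | no  _  | yes Z0 | yes Z'0 = trans Z0 (sym Z'0)
  ... | no  Kb | yes Z0 | no  _   =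
        ⊥-elim (nonzero-off-coline LK LZ LC C≉0 chK K⊆Z K⊆C Ca Za≢0 Cb Kb Z0)
  ... | no  Kb | no  _  | yes Z'0 =
        ⊥-elim (nonzero-off-coline LK LZ' LC C≉0 chK K⊆Z' K⊆C Ca (λ p → Za≢0 (trans Za≡Z'a p)) Cb Kb Z'0)
  ... | no  Kb | no Zb  | no  Z'b with Z b ≟ˢ Z' b
  ...   | yes Zb≡Z'b = Zb≡Z'b
  ...   | no  Zb≢Z'b with L3 Z Z' LZ LZ' b (≢⇒≡negS Zb Z'b Zb≢Z'b , Zb)
  ...     | V , LV , Vb , out =
            ⊥-elim (nonzero-off-coline LK LV LC C≉0 chK K⊆V K⊆C Ca
                      (λ p → Za≢0 (trans (sym (eliminant-agrees out Za≡Z'a)) p)) Cb Kb Vb)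
    where
    K⊆V : K ⊆z V
    K⊆V x K0 = trans (eliminant-agrees out (trans (K⊆Z x K0) (sym (K⊆Z' x K0)))) (K⊆Z x K0)

  module Hyperplane (g f : Fin n) {C : SVec n} (cC : Cocircuit O C) (Cg : C g ≡ zer) (Cf : C f ≡ zer) where

    LC : L C
    LC = proj₁ cC

    C≉0 : ¬ C ≈ zeroV
    C≉0 = proj₁ (proj₂ cC)

    module Line (P P1 : SVec n) (cP : Cocircuit O P) (cP1 : Cocircuit O P1)
                (Pg : P g ≡ plus) (P1g : P1 g ≡ plus) (frCP : FlatRank O (C ∘ P) (suc R))
                (P∘C⊆P1 : (P ∘ C) ⊆z P1) (P≉P1 : ¬ P ≈ P1) where

      LP : L P
      LP = proj₁ cP

      LP1 : L P1
      LP1 = proj₁ cP1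

      Pg≢0 : P g ≢ zer
      Pg≢0 p = plus≢zer (trans (sym Pg) p)

      P1g≢0 : P1 g ≢ zer
      P1g≢0 p = plus≢zer (trans (sym P1g) p)

      chain-P∘C : HasChain O (suc R) (P ∘ C)
      chain-P∘C = HasChain-mono (∘-comm-⊆z C P) (proj₁ frCP)

      agrees-on-C : ∀ {e} → C e ≡ zer → P1 e ≡ P e
      agrees-on-C Ce = sym (agreement-spreads (L2 P C LP LC) LP LP1 LC C≉0 chain-P∘C
                              (∘-⊆zˡ P C) P∘C⊆P1 (∘-⊆zʳ P C) Cg (trans Pg (sym P1g)) Pg≢0 Ce)

      zeros-meet-in-C : ∀ {x} → P1 x ≡ zer → P x ≡ zer → C x ≡ zer
      zeros-meet-in-C {x} P1x Px with C x ≟ˢ zer | ⊆z⊎∃ P P1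
      ... | yes C0  | _ = C0
      ... | no  C≢0 | inj₂ (y , Py , P1y) =
            ⊥-elim (nonzero-off-coline (L2 P C LP LC) LP1 LP (λ q → Pg≢0 (q g)) chain-P∘C
                      P∘C⊆P1 (∘-⊆zˡ P C) Py P1y Px (∘-nonzeroʳ P C C≢0) P1x)
      ... | no  C≢0 | inj₁ P⊆P1 with covector-⊃z LP LP1 Pg P1g P⊆P1 P≉P1
      ...   | W , LW , W≉0 , P⊆W , d , Wd , Pd =
            ⊥-elim (nonzero-off-coline (L2 P C LP LC) LP LW W≉0 chain-P∘C
                      (∘-⊆zˡ P C) (⊆z-trans (∘-⊆zˡ P C) P⊆W) Wd Pd (P⊆W x Px) (∘-nonzeroʳ P C C≢0) Px)

      P1∘P⊆C : (P1 ∘ P) ⊆z C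
      P1∘P⊆C x p = zeros-meet-in-C (∘-⊆zˡ P1 P x p) (∘-⊆zʳ P1 P x p)

      chain-P1∘P : HasChain O (suc R) (P1 ∘ P)
      chain-P1∘P = HasChain-mono (⊆z-∘ P1 P P∘C⊆P1 (∘-⊆zˡ P C)) chain-P∘C

      comodular : Comodular O (3 + R) P1 P
      comodular = comodular-of-signs (3 + R) cP1 cP (λ q → P≉P1 (λ x → sym (q x))) P1g Pg
                                     (chain-P1∘P , no-longer)
        where
        no-longer : ¬ HasChain O (2 + R) (P1 ∘ P)
        no-longer ch = proj₂ frCP (HasChain-mono (⊆z-∘ C P P1∘P⊆C (∘-⊆zʳ P1 P)) ch)

      bidirected : Bi O (3 + R) g f P1 P
      bidirected with elimination-exists comodular P1g Pg
      ... | Z , el@((LZ , _) , Zg , _) = comodular , trans P1g (sym Pg) , P1g≢0 , Z , el , Zf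
        where
        Zf : Z f ≡ zer
        Zf with Z f ≟ˢ zer
        ... | yes Z0  = Z0
        ... | no  Z≢0 = ⊥-elim (nonzero-off-coline (L2 P1 P LP1 LP) LZ LC C≉0 chain-P1∘P
                                  (Elim-⊆z el) P1∘P⊆C Cf Z≢0 Cg (∘-nonzeroˡ P1 P P1g≢0) Zg)

    Dir-transfer : ∀ {s A B A' B'} → Comodular O (3 + R) A' B' → A' g ≡ plus → B' g ≡ plus →
                   (∀ {Z Z'} → Elim O g (- A) B Z → Elim O g (- A') B' Z' → Z f ≡ Z' f) →
                   Dir O (3 + R) g f s A B → Dir O (3 + R) g f s A' B'
    Dir-transfer com A'g B'g same (_ , _ , _ , Z , el , Zf) with elimination-exists com A'g B'g
    ... | Z' , el' = com , trans A'g (sym B'g) , (λ p → plus≢zer (trans (sym A'g) p)) ,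
                     Z' , el' , trans (sym (same el el')) Zf

    anchor : ∀ X Y → HasChain O (suc R) (X ∘ C) → ¬ HasChain O (suc R) (C ∘ (X ∘ Y)) →
             Σ (Fin n) λ h → X h ≡ zer × C h ≡ zer × Y h ≢ zer
    anchor X Y chXC ¬chF with ⊆z⊎∃ (X ∘ C) Y
    ... | inj₁ X∘C⊆Y =
          ⊥-elim (¬chF (HasChain-mono (⊆z-∘ C (X ∘ Y) (∘-⊆zʳ X C) (⊆z-∘ X Y (∘-⊆zˡ X C) X∘C⊆Y)) chXC))
    ... | inj₂ (h , XC0 , Yh) = h , ∘-⊆zˡ X C h XC0 , ∘-⊆zʳ X C h XC0 , Yh

    elimination-signs-agree :
      ∀ X Y X1 Y1 → Comodular O (3 + R) X Y → Comodular O (3 + R) X1 Y1 → X g ≡ plus → X1 g ≡ plus →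
      HasChain O (suc R) (X ∘ C) → FlatRank O (C ∘ (X ∘ Y)) R →
      (X ∘ C) ⊆z X1 → (Y ∘ C) ⊆z Y1 → (∀ {e} → C e ≡ zer → Y1 e ≡ Y e) →
      ∀ {Z Z'} → Elim O g (- X) Y Z → Elim O g (- X1) Y1 Z' → Z f ≡ Z' f
    elimination-signs-agree X Y X1 Y1 comXY@((LX , _) , (LY , _) , _) comX1Y1 Xg X1g chXC (chF , ¬chF)
                            X∘C⊆X1 Y∘C⊆Y1 Y1≡Y {Z} {Z'} el@((LZ , _) , Zg , _) el'@((LZ' , _) , Z'g , _)
      with anchor X Y chXC ¬chF
    ... | h , Xh , Ch , Yh =
      agreement-spreads (L2 Z (C ∘ Z') LZ (L2 C Z' LC LZ')) LZ LZ' LC C≉0 chK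
        (∘-⊆zˡ Z (C ∘ Z')) (⊆z-trans (∘-⊆zʳ Z (C ∘ Z')) (∘-⊆zʳ C Z'))
        (⊆z-trans (∘-⊆zʳ Z (C ∘ Z')) (∘-⊆zˡ C Z')) Ch Zh≡Z'h Zh≢0 Cf
      where
      Zh≡Yh : Z h ≡ Y h
      Zh≡Yh = elimination-at comXY Xg el Xh Yh

      Z'h≡Y1h : Z' h ≡ Y1 h
      Z'h≡Y1h = elimination-at comX1Y1 X1g el' (X∘C⊆X1 h (∘-vanishes X C Xh Ch))
                               (λ p → Yh (trans (sym (Y1≡Y Ch)) p))

      Zh≡Z'h : Z h ≡ Z' h
      Zh≡Z'h = trans Zh≡Yh (trans (sym (Y1≡Y Ch)) (sym Z'h≡Y1h))

      Zh≢0 : Z h ≢ zer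
      Zh≢0 p = Yh (trans (sym Zh≡Yh) p)

      F⊆X∘Y : (C ∘ (X ∘ Y)) ⊆z (X ∘ Y)
      F⊆X∘Y = ∘-⊆zʳ C (X ∘ Y)

      F⊆X1∘Y1 : (C ∘ (X ∘ Y)) ⊆z (X1 ∘ Y1)
      F⊆X1∘Y1 = ⊆z-∘ X1 Y1
        (⊆z-trans (⊆z-∘ X C (⊆z-trans F⊆X∘Y (∘-⊆zˡ X Y)) (∘-⊆zˡ C (X ∘ Y))) X∘C⊆X1)
        (⊆z-trans (⊆z-∘ Y C (⊆z-trans F⊆X∘Y (∘-⊆zʳ X Y)) (∘-⊆zˡ C (X ∘ Y))) Y∘C⊆Y1)

      chK : HasChain O (suc R) (Z ∘ (C ∘ Z'))
      chK = chain-step (L2 C (X ∘ Y) LC (L2 X Y LX LY))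
              (⊆z-∘ Z (C ∘ Z') (⊆z-trans F⊆X∘Y (Elim-⊆z el))
                               (⊆z-∘ C Z' (∘-⊆zˡ C (X ∘ Y)) (⊆z-trans F⊆X1∘Y1 (Elim-⊆z el'))))
              (∘-vanishes Z (C ∘ Z') Zg (∘-vanishes C Z' Cg Z'g))
              (λ p → plus≢zer (trans (sym Xg) (∘-⊆zˡ X Y g (F⊆X∘Y g p))))
              chF

lemma4p7 : (n : ℕ) (O : OM n) (r : ℕ) → Rank O r → 3 ≤ r →
    (g f : Fin n) → IsProgram O g f →
    (C X Y : SVec n) →
    Comodular O r C X → Comodular O r C Y → Comodular O r X Y →
    FlatRank O (C ∘ (X ∘ Y)) (r ∸ 3) →
    X g ≡ plus → Y g ≡ plus → C g ≡ zer → C f ≡ zer →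
    (X1 Y1 : SVec n) → Cocircuit O X1 → Cocircuit O Y1 → ¬ (X1 ≈ Y1) →
    X1 g ≡ plus → Y1 g ≡ plus →
    (X ∘ C) ⊆z X1 → (Y ∘ C) ⊆z Y1 →
    ¬ (X ≈ X1) → ¬ (X1 ≈ C) → ¬ (Y ≈ Y1) → ¬ (Y1 ≈ C) →
    FlatRank O (X1 ∘ Y1) (r ∸ 2) →
    Bi O r g f X1 X × Bi O r g f Y1 Y × (Arr O r g f X1 Y1 ⇔ Arr O r g f X Y)
lemma4p7 n O (suc (suc (suc R))) (_ , rank) (s≤s (s≤s (s≤s z≤n))) g f _ C X Y
  (cC , cX , _ , _ , frCX) (_ , cY , _ , _ , frCY) comXY frF Xg Yg Cg Cf
  X1 Y1 cX1 cY1 X1≉Y1 X1g Y1g X∘C⊆X1 Y∘C⊆Y1 X≉X1 _ Y≉Y1 _ frX1Y1 =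
  LineX.bidirected , LineY.bidirected ,
  mk⇔ (Dir-transfer comXY Xg Yg λ el el' → sym (signs-agree el' el))
      (Dir-transfer comX1Y1 X1g Y1g signs-agree)
  where
  open Chains O R rank
  open Hyperplane g f cC Cg Cf
  module LineX = Line X X1 cX cX1 Xg X1g frCX X∘C⊆X1 X≉X1
  module LineY = Line Y Y1 cY cY1 Yg Y1g frCY Y∘C⊆Y1 Y≉Y1

  comX1Y1 : Comodular O (3 + R) X1 Y1
  comX1Y1 = comodular-of-signs (3 + R) cX1 cY1 X1≉Y1 X1g Y1g frX1Y1

  signs-agree : ∀ {Z Z'} → Elim O g (- X) Y Z → Elim O g (- X1) Y1 Z' → Z f ≡ Z' f
  signs-agree = elimination-signs-agree X Y X1 Y1 comXY comX1Y1 Xg X1g LineX.chain-P∘C frF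
                                        X∘C⊆X1 Y∘C⊆Y1 LineY.agrees-on-C
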